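{- For every integer $n\ge 3$, $F_{cd}(C_n\,\Box\, P_2) = n$.
   Context: $C_n\,\Box\,P_2$ is the Cartesian product of the cycle $C_n$ and the path $P_2$: two disjoint copies $v_1\cdots v_n$ and $v_1'\cdots v_n'$ of $C_n$ with each $v_i$ adjacent to $v_i'$. Color-change rule: if each vertex is colored black or white, and a black vertex $u$ has exactly one white neighbor $v$, then $v$ is recolored black. A zero forcing set is a vertex set $Z$ such that, starting with exactly the vertices of $Z$ black, repeated application of the color-change rule colors every vertex black. A connected dom-forcing set is a vertex set $S$ that is dominating (every vertex is in $S$ or adjacent to a vertex of $S$), induces a connected subgraph, and is a zero forcing set; $F_{cd}(\cdot)$ is the minimum size of such a set. -}

module Defs where

open import Data.Nat using (ℕ; zero; suc; _≤_)
open import Data.Fin using (Fin; toℕ)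
open import Data.Bool using (Bool; not)
open import Data.Product using (_×_; _,_; ∃; Σ)
open import Data.Sum using (_⊎_)
open import Data.List using (List; length)
open import Data.List.Membership.Propositional using (_∈_)
open import Data.List.Relation.Unary.Unique.Propositional using (Unique)
open import Relation.Binary.PropositionalEquality using (_≡_; _≢_)

-- Vertices of C_n □ P_2: (i , b) with i ∈ {0..n-1} the cycle position and
-- b : Bool the copy (false = v_i, true = v_i').
V : ℕ → Set
V n = Fin n × Bool

CycSucc : ∀ {n} → Fin n → Fin n → Set
CycSucc {n} i j = (suc (toℕ i) ≡ toℕ j) ⊎ (suc (toℕ i) ≡ n × toℕ j ≡ 0)

data Adj {n : ℕ} : V n → V n → Set where
  cycFwd : ∀ {i j b} → CycSucc i j → Adj (i , b) (j , b)
  cycBwd : ∀ {i j b} → CycSucc j i → Adj (i , b) (j , b)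
  rung   : ∀ {i b} → Adj (i , b) (i , not b)

-- Vertex sets are duplicate-free lists; the size of a set is its length.
-- Forced Z v : v becomes black when starting with exactly Z black and
-- repeatedly applying the colour-change rule (the final coloring / closure):
-- either v ∈ Z, or some black u adjacent to v has all neighbours other than v black.
data Forced {n : ℕ} (Z : List (V n)) : V n → Set where
  init  : ∀ {v} → v ∈ Z → Forced Z v
  force : ∀ {u v} → Forced Z u → Adj u v →
          (∀ w → Adj u w → w ≢ v → Forced Z w) → Forced Z v

IsZeroForcing : ∀ {n} → List (V n) → Set
IsZeroForcing {n} Z = ∀ (v : V n) → Forced Z v

IsDominating : ∀ {n} → List (V n) → Set
IsDominating {n} S = ∀ (v : V n) → v ∈ S ⊎ Σ (V n) (λ u → u ∈ S × Adj u v)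

data ReachIn {n : ℕ} (S : List (V n)) (u : V n) : V n → Set where
  here : u ∈ S → ReachIn S u u
  step : ∀ {w v} → ReachIn S u w → Adj w v → v ∈ S → ReachIn S u v

IsConnectedIn : ∀ {n} → List (V n) → Set
IsConnectedIn {n} S = ∀ (u v : V n) → u ∈ S → v ∈ S → ReachIn S u v

IsConnDomForcing : ∀ {n} → List (V n) → Set
IsConnDomForcing S = Unique S × IsDominating S × IsConnectedIn S × IsZeroForcing S

FcdIs : ℕ → ℕ → Set
FcdIs n k =
  (Σ (List (V n)) λ S → IsConnDomForcing S × length S ≡ k) ×
  (∀ (S : List (V n)) → IsConnDomForcing S → k ≤ length S)

-- The copy v₁ ⋯ vₙ of Cₙ is connected, dominates v′ᵢ through the rungs, and each vᵢ forces v′ᵢ,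
-- so F_cd ≤ n. Conversely let S be a connected dom-forcing set. If S meets all n columns
-- {vᵢ, v′ᵢ} it has n vertices. Otherwise rotate so that column 0 is empty. A vertex of an empty
-- column is dominated only along its row, so the empty columns form an arc of length one or two,
-- and since S cannot walk across column 0, connectivity makes it meet every column in between.
-- For one empty column, S has vertices in both rows, and a walk between them uses a rung, giving a
-- full column: (n - 1) + 1 vertices. For two empty columns, the two columns flanking the gap are
-- full: (n - 2) + 2 vertices, unless n = 3 where S lies in a single column and cannot force.
module Submission where

open import Defs
open import Data.Nat using (ℕ; zero; suc; _+_; _≤_; _≤?_; _≟_; z≤n; s≤s)
open import Data.Nat.Properties using (≤-trans; ≤-reflexive; ≤-antisym; n≤1+n; ≰⇒>; <⇒≢)
import Data.Nat.Properties as ℕₚ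
open import Data.Fin as Fin using (Fin; zero; suc; toℕ; fromℕ; inject₁; lower₁; splitAt; join)
import Data.Fin.Properties as Finₚ
open import Data.Fin.Induction using (<-weakInduction)
open import Data.Bool as Bool using (Bool; true; false; not)
open import Data.Bool.Properties using (not-involutive)
open import Data.Product using (∃; ∃-syntax; _×_; _,_; proj₁; proj₂; map₁)
open import Data.Product.Properties using (≡-dec)
open import Data.Sum using (_⊎_; inj₁; inj₂; [_,_]′)
open import Data.List using (List; length; map; allFin; lookup)
open import Data.List.Properties using (length-map; length-tabulate)
open import Data.List.Membership.Propositional using (_∈_)
open import Data.List.Membership.Propositional.Properties using (∈-map⁺; ∈-map⁻; ∈-allFin)
import Data.List.Relation.Unary.Any as Any
open import Data.List.Relation.Unary.Any.Properties using (lookup-index)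
import Data.List.Relation.Unary.Unique.Propositional.Properties as Uniqueₚ
open import Function using (_∘_; id)
open import Function.Definitions using (Injective)
open import Relation.Nullary using (¬_; Dec; yes; no; does; contradiction)
open import Relation.Nullary.Decidable using (map′)
open import Relation.Binary.PropositionalEquality

private variable
  k m n : ℕ

next : Fin (suc k) → Fin (suc k)
next {k} i with k ≟ toℕ i
... | yes _   = zero
... | no  k≢i = suc (lower₁ i k≢i)

prev : Fin (suc k) → Fin (suc k)
prev {k} zero    = fromℕ k
prev     (suc i) = inject₁ i

CycSucc-next : (i : Fin (suc k)) → CycSucc i (next i)
CycSucc-next {k} i with k ≟ toℕ i
... | yes k≡i = inj₂ (cong suc (sym k≡i) , refl)
... | no  k≢i = inj₁ (cong suc (sym (Finₚ.toℕ-lower₁ i k≢i)))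

CycSucc-prev : (j : Fin (suc k)) → CycSucc (prev j) j
CycSucc-prev {k} zero    = inj₂ (cong suc (Finₚ.toℕ-fromℕ k) , refl)
CycSucc-prev     (suc j) = inj₁ (cong suc (Finₚ.toℕ-inject₁ j))

CycSucc-functional : {i j j′ : Fin n} → CycSucc i j → CycSucc i j′ → j ≡ j′
CycSucc-functional (inj₁ p) (inj₁ q) = Finₚ.toℕ-injective (trans (sym p) q)
CycSucc-functional {j = j} (inj₁ p) (inj₂ (q , _)) =
  contradiction (trans (sym p) q) (<⇒≢ (Finₚ.toℕ<n j))
CycSucc-functional {j′ = j′} (inj₂ (p , _)) (inj₁ q) =
  contradiction (trans (sym q) p) (<⇒≢ (Finₚ.toℕ<n j′))
CycSucc-functional (inj₂ (_ , p)) (inj₂ (_ , q)) = Finₚ.toℕ-injective (trans p (sym q))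

CycSucc-injective : {i j l : Fin n} → CycSucc i l → CycSucc j l → i ≡ j
CycSucc-injective (inj₁ p)       (inj₁ q)       = Finₚ.toℕ-injective (ℕₚ.suc-injective (trans p (sym q)))
CycSucc-injective (inj₁ p)       (inj₂ (_ , q)) = contradiction (trans p q) λ ()
CycSucc-injective (inj₂ (_ , p)) (inj₁ q)       = contradiction (trans q p) λ ()
CycSucc-injective (inj₂ (p , _)) (inj₂ (q , _)) = Finₚ.toℕ-injective (ℕₚ.suc-injective (trans p (sym q)))

next∘prev : (j : Fin (suc k)) → next (prev j) ≡ j
next∘prev j = CycSucc-functional (CycSucc-next (prev j)) (CycSucc-prev j)

prev∘next : (i : Fin (suc k)) → prev (next i) ≡ i
prev∘next i = CycSucc-injective (CycSucc-prev (next i)) (CycSucc-next i)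

next-CycSucc : {i j : Fin (suc k)} → CycSucc i j → CycSucc (next i) (next j)
next-CycSucc {i = i} c =
  subst (λ j → CycSucc (next i) (next j)) (sym (CycSucc-functional c (CycSucc-next i)))
    (CycSucc-next (next i))

prev-CycSucc : {i j : Fin (suc k)} → CycSucc i j → CycSucc (prev i) (prev j)
prev-CycSucc {j = j} c =
  subst (λ i → CycSucc (prev i) (prev j)) (CycSucc-injective (CycSucc-prev j) c)
    (CycSucc-prev (prev j))

Adj-sym : {u v : V n} → Adj u v → Adj v u
Adj-sym (cycFwd c) = cycBwd c
Adj-sym (cycBwd c) = cycFwd c
Adj-sym {u = i , b} rung = subst (λ b′ → Adj (i , not b) (i , b′)) (not-involutive b) rung

Adj-cases : {i : Fin (suc k)} {b : Bool} {v : V (suc k)} → Adj (i , b) v →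
            v ≡ (next i , b) ⊎ v ≡ (prev i , b) ⊎ v ≡ (i , not b)
Adj-cases {i = i} (cycFwd c) = inj₁ (cong (_, _) (CycSucc-functional c (CycSucc-next i)))
Adj-cases {i = i} (cycBwd c) = inj₂ (inj₁ (cong (_, _) (CycSucc-injective c (CycSucc-prev i))))
Adj-cases         rung       = inj₂ (inj₂ refl)

map₁-Adj : {f : Fin n → Fin n} → (∀ {i j} → CycSucc i j → CycSucc (f i) (f j)) →
           ∀ {u v} → Adj u v → Adj (map₁ f u) (map₁ f v)
map₁-Adj f-CycSucc (cycFwd c) = cycFwd (f-CycSucc c)
map₁-Adj f-CycSucc (cycBwd c) = cycBwd (f-CycSucc c)
map₁-Adj f-CycSucc rung       = rung

module _ {S : List (V n)} where

  ReachIn-∈ : ∀ {u v} → ReachIn S u v → v ∈ S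
  ReachIn-∈ (here u∈)     = u∈
  ReachIn-∈ (step _ _ v∈) = v∈

  ReachIn-trans : ∀ {u v w} → ReachIn S u v → ReachIn S v w → ReachIn S u w
  ReachIn-trans r (here _)       = r
  ReachIn-trans r (step r′ a w∈) = step (ReachIn-trans r r′) a w∈

  ReachIn-sym : ∀ {u v} → ReachIn S u v → ReachIn S v u
  ReachIn-sym (here u∈)     = here u∈
  ReachIn-sym (step r a v∈) = ReachIn-trans (step (here v∈) (Adj-sym a) (ReachIn-∈ r)) (ReachIn-sym r)

  hub⇒IsConnectedIn : (h : V n) → (∀ {v} → v ∈ S → ReachIn S h v) → IsConnectedIn S
  hub⇒IsConnectedIn h reach u v u∈ v∈ = ReachIn-trans (ReachIn-sym (reach u∈)) (reach v∈)

module Automorphism (σ σ⁻¹ : V n → V n)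
  (σ∘σ⁻¹ : ∀ v → σ (σ⁻¹ v) ≡ v) (σ⁻¹∘σ : ∀ v → σ⁻¹ (σ v) ≡ v)
  (σ-Adj : ∀ {u v} → Adj u v → Adj (σ u) (σ v))
  (σ⁻¹-Adj : ∀ {u v} → Adj u v → Adj (σ⁻¹ u) (σ⁻¹ v)) where

  σ-injective : Injective _≡_ _≡_ σ
  σ-injective {u} {v} eq = trans (sym (σ⁻¹∘σ u)) (trans (cong σ⁻¹ eq) (σ⁻¹∘σ v))

  Forced-map : ∀ {Z v} → Forced Z v → Forced (map σ Z) (σ v)
  Forced-map (init v∈) = init (∈-map⁺ σ v∈)
  Forced-map {Z} (force {u} {v} fu a others) = force (Forced-map fu) (σ-Adj a) others′
    where
    others′ : ∀ w → Adj (σ u) w → w ≢ σ v → Forced (map σ Z) w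
    others′ w a′ w≢σv = subst (Forced (map σ Z)) (σ∘σ⁻¹ w) (Forced-map (others (σ⁻¹ w)
      (subst (λ x → Adj x (σ⁻¹ w)) (σ⁻¹∘σ u) (σ⁻¹-Adj a′))
      (λ eq → w≢σv (trans (sym (σ∘σ⁻¹ w)) (cong σ eq)))))

  ReachIn-map : ∀ {S u v} → ReachIn S u v → ReachIn (map σ S) (σ u) (σ v)
  ReachIn-map (here u∈)     = here (∈-map⁺ σ u∈)
  ReachIn-map (step r a v∈) = step (ReachIn-map r) (σ-Adj a) (∈-map⁺ σ v∈)

  IsConnDomForcing-map : ∀ {S} → IsConnDomForcing S → IsConnDomForcing (map σ S)
  IsConnDomForcing-map {S} (unique , dom , conn , forcing) =
    Uniqueₚ.map⁺ σ-injective unique , dom′ , conn′ , forcing′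
    where
    dom′ : IsDominating (map σ S)
    dom′ w with dom (σ⁻¹ w)
    ... | inj₁ w∈           = inj₁ (subst (_∈ map σ S) (σ∘σ⁻¹ w) (∈-map⁺ σ w∈))
    ... | inj₂ (u , u∈ , a) = inj₂ (σ u , ∈-map⁺ σ u∈ , subst (Adj (σ u)) (σ∘σ⁻¹ w) (σ-Adj a))
    conn′ : IsConnectedIn (map σ S)
    conn′ u′ v′ u′∈ v′∈ with ∈-map⁻ σ u′∈ | ∈-map⁻ σ v′∈
    ... | u , u∈ , refl | v , v∈ , refl = ReachIn-map (conn u v u∈ v∈)
    forcing′ : IsZeroForcing (map σ S)
    forcing′ w = subst (Forced (map σ S)) (σ∘σ⁻¹ w) (Forced-map (forcing (σ⁻¹ w)))

MeetsColumn : List (V n) → Fin n → Set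
MeetsColumn S i = ∃[ b ] (i , b) ∈ S

ContainsColumn : List (V n) → Fin n → Set
ContainsColumn S i = (i , false) ∈ S × (i , true) ∈ S

module Rotation (f f⁻¹ : Fin (suc k) → Fin (suc k))
  (f∘f⁻¹ : ∀ i → f (f⁻¹ i) ≡ i) (f⁻¹∘f : ∀ i → f⁻¹ (f i) ≡ i)
  (f-CycSucc : ∀ {i j} → CycSucc i j → CycSucc (f i) (f j))
  (f⁻¹-CycSucc : ∀ {i j} → CycSucc i j → CycSucc (f⁻¹ i) (f⁻¹ j)) where

  open Automorphism (map₁ f) (map₁ f⁻¹)
    (λ (i , b) → cong (_, b) (f∘f⁻¹ i)) (λ (i , b) → cong (_, b) (f⁻¹∘f i))
    (map₁-Adj f-CycSucc) (map₁-Adj f⁻¹-CycSucc) public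

  ¬MeetsColumn-map : ∀ {S i} → ¬ MeetsColumn S i → ¬ MeetsColumn (map (map₁ f) S) (f i)
  ¬MeetsColumn-map {S} {i} ¬meets (b , fi∈) with ∈-map⁻ (map₁ f) fi∈
  ... | (j , b′) , j∈ , eq = ¬meets (b , subst (_∈ S) (sym (cong₂ _,_ i≡j (cong proj₂ eq))) j∈)
    where
    i≡j : i ≡ j
    i≡j = trans (sym (f⁻¹∘f i)) (trans (cong (f⁻¹ ∘ proj₁) eq) (f⁻¹∘f j))

module RotateBack {k} = Rotation {k} prev next prev∘next next∘prev prev-CycSucc next-CycSucc
module RotateForward {k} = Rotation {k} next prev next∘prev prev∘next next-CycSucc prev-CycSucc

module _ {A : Set} {xs : List A} where

  injection⇒≤length : (f : Fin k → A) → Injective _≡_ _≡_ f → (∀ i → f i ∈ xs) → k ≤ length xs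
  injection⇒≤length f f-injective f∈ = Finₚ.injective⇒≤ index-injective
    where
    index-injective : Injective _≡_ _≡_ (λ i → Any.index (f∈ i))
    index-injective {i} {j} eq = f-injective (begin
      f i                          ≡⟨ lookup-index (f∈ i) ⟩
      lookup xs (Any.index (f∈ i)) ≡⟨ cong (lookup xs) eq ⟩
      lookup xs (Any.index (f∈ j)) ≡⟨ lookup-index (f∈ j) ⟨
      f j                          ∎)
      where open ≡-Reasoning

  injections⇒≤length : (f : Fin k → A) (g : Fin m → A) →
                       Injective _≡_ _≡_ f → Injective _≡_ _≡_ g → (∀ i j → f i ≢ g j) →
                       (∀ i → f i ∈ xs) → (∀ j → g j ∈ xs) → k + m ≤ length xs
  injections⇒≤length {k} {m} f g f-injective g-injective f≢g f∈ g∈ =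
    injection⇒≤length ([ f , g ]′ ∘ splitAt k) (splitAt-injective ∘ [f,g]-injective) (∈xs ∘ splitAt k)
    where
    [f,g]-injective : Injective _≡_ _≡_ [ f , g ]′
    [f,g]-injective {inj₁ i} {inj₁ i′} eq = cong inj₁ (f-injective eq)
    [f,g]-injective {inj₁ i} {inj₂ j}  eq = contradiction eq (f≢g i j)
    [f,g]-injective {inj₂ j} {inj₁ i}  eq = contradiction (sym eq) (f≢g i j)
    [f,g]-injective {inj₂ j} {inj₂ j′} eq = cong inj₂ (g-injective eq)
    splitAt-injective : Injective _≡_ _≡_ (splitAt k {m})
    splitAt-injective {i} {j} eq = begin
      i                      ≡⟨ Finₚ.join-splitAt k m i ⟨
      join k m (splitAt k i) ≡⟨ cong (join k m) eq ⟩
      join k m (splitAt k j) ≡⟨ Finₚ.join-splitAt k m j ⟩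
      j                      ∎
      where open ≡-Reasoning
    ∈xs : ∀ s → [ f , g ]′ s ∈ xs
    ∈xs (inj₁ i) = f∈ i
    ∈xs (inj₂ j) = g∈ j

module _ {n : ℕ} where
  open import Data.List.Membership.DecPropositional (≡-dec (Finₚ._≟_ {n}) Bool._≟_) using (_∈?_)

  -- Preferring (i , false) makes the pick differ from (i , true) whenever S contains column i.
  pick : List (V n) → Fin n → V n
  pick S i = i , not (does ((i , false) ∈? S))

  pick-∈ : ∀ {S i} → MeetsColumn S i → pick S i ∈ S
  pick-∈ {S} {i} meets with (i , false) ∈? S
  ... | yes f∈ = f∈
  ... | no  f∉ with meets
  ...   | false , f∈ = contradiction f∈ f∉
  ...   | true  , t∈ = t∈

  pick-row : ∀ {S i} → (i , false) ∈ S → proj₂ (pick S i) ≡ false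
  pick-row {S} {i} f∈ with (i , false) ∈? S
  ... | yes _  = refl
  ... | no  f∉ = contradiction f∈ f∉

  meets? : ∀ S i → Dec (MeetsColumn S i)
  meets? S i = map′ (proj₂ (pick S i) ,_) pick-∈ (pick S i ∈? S)

  meets-all⇒≤length : ∀ {S} → (∀ i → MeetsColumn S i) → n ≤ length S
  meets-all⇒≤length {S} meets = injection⇒≤length (pick S) (cong proj₁) (pick-∈ ∘ meets)

  contains+meets⇒≤length : ∀ {S} (d : Fin k → Fin n) (c : Fin m → Fin n) →
                           Injective _≡_ _≡_ d → Injective _≡_ _≡_ c →
                           (∀ l → ContainsColumn S (d l)) → (∀ j → MeetsColumn S (c j)) →
                           k + m ≤ length S
  contains+meets⇒≤length {S = S} d c d-injective c-injective contains meets =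
    injections⇒≤length (λ l → d l , true) (pick S ∘ c)
      (d-injective ∘ cong proj₁) (c-injective ∘ cong proj₁) distinct
      (proj₂ ∘ contains) (pick-∈ ∘ meets)
    where
    distinct : ∀ l j → (d l , true) ≢ pick S (c j)
    distinct l j eq = contradiction (trans (cong proj₂ eq) (pick-row cj∈)) λ ()
      where
      cj∈ : (c j , false) ∈ S
      cj∈ = subst (λ i → (i , false) ∈ S) (cong proj₁ eq) (proj₁ (contains l))

module _ {S : List (V n)} where

  meets-toℕ : ∀ {x c} → x ∈ S → toℕ (proj₁ x) ≡ toℕ c → MeetsColumn S c
  meets-toℕ {i , b} x∈ eq = b , subst (λ j → (j , b) ∈ S) (Finₚ.toℕ-injective eq) x∈

  rung-contains : ∀ {i b} → (i , b) ∈ S → (i , not b) ∈ S → ContainsColumn S i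
  rung-contains {b = false} x∈ y∈ = x∈ , y∈
  rung-contains {b = true}  x∈ y∈ = y∈ , x∈

  ReachIn-row : ∀ {u v} → ReachIn S u v → proj₂ u ≡ proj₂ v ⊎ ∃ (ContainsColumn S)
  ReachIn-row (here _)              = inj₁ refl
  ReachIn-row (step r (cycFwd _) _) = ReachIn-row r
  ReachIn-row (step r (cycBwd _) _) = ReachIn-row r
  ReachIn-row (step r rung v∈)      = inj₂ (_ , rung-contains (ReachIn-∈ r) v∈)

  two-rows⇒contains : IsConnectedIn S → ∀ {i j} → (i , false) ∈ S → (j , true) ∈ S → ∃ (ContainsColumn S)
  two-rows⇒contains conn f∈ t∈ with ReachIn-row (conn _ _ f∈ t∈)
  ... | inj₁ ()
  ... | inj₂ contains = contains

module _ {S : List (V (suc k))} (dom : IsDominating S) {i : Fin (suc k)} (i∉ : ¬ MeetsColumn S i) where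

  missed-column-dominator : ∀ b → (next i , b) ∈ S ⊎ (prev i , b) ∈ S
  missed-column-dominator b with dom (i , b)
  ... | inj₁ i∈ = contradiction (b , i∈) i∉
  ... | inj₂ (u , u∈ , a) with Adj-cases (Adj-sym a)
  ...   | inj₁ refl        = inj₁ u∈
  ...   | inj₂ (inj₁ refl) = inj₂ u∈
  ...   | inj₂ (inj₂ refl) = contradiction (not b , u∈) i∉

  missed-column⇒row-met : ∀ b → ∃[ j ] (j , b) ∈ S
  missed-column⇒row-met b = [ (next i ,_) , (prev i ,_) ]′ (missed-column-dominator b)

  next-contains : ¬ MeetsColumn S (prev i) → ContainsColumn S (next i)
  next-contains prev∉ = dominator false , dominator true
    where
    dominator : ∀ b → (next i , b) ∈ S
    dominator b = [ id , (λ p∈ → contradiction (b , p∈) prev∉) ]′ (missed-column-dominator b)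

  prev-contains : ¬ MeetsColumn S (next i) → ContainsColumn S (prev i)
  prev-contains next∉ = dominator false , dominator true
    where
    dominator : ∀ b → (prev i , b) ∈ S
    dominator b = [ (λ n∈ → contradiction (b , n∈) next∉) , id ]′ (missed-column-dominator b)

-- With column 0 empty, walks in S cannot wrap around the cycle, so they sweep columns as on a path.
module _ {S : List (V (suc k))} (zero∉ : ¬ MeetsColumn S zero) where

  column-step : ∀ {w v} → w ∈ S → v ∈ S → Adj w v → toℕ (proj₁ v) ≤ suc (toℕ (proj₁ w))
  column-step _  _  (cycFwd (inj₁ p))       = ≤-reflexive (sym p)
  column-step _  v∈ (cycFwd (inj₂ (_ , p))) = contradiction (meets-toℕ v∈ p) zero∉
  column-step _  _  (cycBwd (inj₁ p))       = ≤-trans (n≤1+n _) (≤-trans (≤-reflexive p) (n≤1+n _))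
  column-step w∈ _  (cycBwd (inj₂ (_ , p))) = contradiction (meets-toℕ w∈ p) zero∉
  column-step _  _  rung                    = n≤1+n _

  between-meets : ∀ {u v c} → ReachIn S u v → proj₁ u Fin.≤ c → c Fin.≤ proj₁ v → MeetsColumn S c
  between-meets (here u∈) u≤c c≤u = meets-toℕ u∈ (≤-antisym u≤c c≤u)
  between-meets {c = c} (step {w} r a v∈) u≤c c≤v with toℕ c ≤? toℕ (proj₁ w)
  ... | yes c≤w = between-meets r u≤c c≤w
  ... | no  c≰w = meets-toℕ v∈ (≤-antisym (≤-trans (column-step (ReachIn-∈ r) v∈ a) (≰⇒> c≰w)) c≤v)

prev≢id₃ : (c : Fin 3) → prev c ≢ c
prev≢id₃ zero             ()
prev≢id₃ (suc zero)       ()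
prev≢id₃ (suc (suc zero)) ()

next≢id₃ : (c : Fin 3) → next c ≢ c
next≢id₃ zero             ()
next≢id₃ (suc zero)       ()
next≢id₃ (suc (suc zero)) ()

prev≢next₃ : (c : Fin 3) → prev c ≢ next c
prev≢next₃ zero             ()
prev≢next₃ (suc zero)       ()
prev≢next₃ (suc (suc zero)) ()

-- A vertex of C₃ □ P₂ has two neighbours outside its column, so no force ever leaves the column.
single-column-not-forcing : ∀ {S : List (V 3)} c → (∀ {x} → x ∈ S → proj₁ x ≡ c) → ¬ IsZeroForcing S
single-column-not-forcing {S} c in-c forcing = prev≢id₃ c (forced-in-c (forcing (prev c , false)))
  where
  forced-in-c : ∀ {v} → Forced S v → proj₁ v ≡ c
  forced-in-c (init v∈) = in-c v∈
  forced-in-c (force {i , b} fu a others) with forced-in-c fu | Adj-cases a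
  ... | refl | inj₁ refl = contradiction
    (forced-in-c (others (prev i , b) (cycBwd (CycSucc-prev i)) (prev≢next₃ i ∘ cong proj₁)))
    (prev≢id₃ i)
  ... | refl | inj₂ (inj₁ refl) = contradiction
    (forced-in-c (others (next i , b) (cycFwd (CycSucc-next i)) (prev≢next₃ i ∘ sym ∘ cong proj₁)))
    (next≢id₃ i)
  ... | refl | inj₂ (inj₂ refl) = refl

one-gap⇒≤length : ∀ {S : List (V (3 + m))} → IsConnDomForcing S → ¬ MeetsColumn S zero →
                  MeetsColumn S (suc zero) → MeetsColumn S (fromℕ (2 + m)) → 3 + m ≤ length S
one-gap⇒≤length {S = S} (_ , dom , conn , _) zero∉ (_ , one∈) (_ , last∈) =
  contains+meets⇒≤length {k = 1} (λ _ → proj₁ full) suc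
    (λ { {zero} {zero} _ → refl }) Finₚ.suc-injective (λ _ → proj₂ full) meets
  where
  row-met = missed-column⇒row-met dom zero∉
  full : ∃ (ContainsColumn S)
  full = two-rows⇒contains conn (proj₂ (row-met false)) (proj₂ (row-met true))
  meets : ∀ j → MeetsColumn S (suc j)
  meets j = between-meets zero∉ (conn _ _ one∈ last∈) (s≤s z≤n) (Finₚ.≤fromℕ (suc j))

two-gap⇒≤length : ∀ {S : List (V (3 + m))} → IsConnDomForcing S → ¬ MeetsColumn S zero →
                  ¬ MeetsColumn S (suc zero) → 3 + m ≤ length S
two-gap⇒≤length {zero} {S} (_ , _ , _ , forcing) zero∉ one∉ =
  contradiction forcing (single-column-not-forcing (suc (suc zero)) in-last)
  where
  in-last : ∀ {x} → x ∈ S → proj₁ x ≡ suc (suc zero)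
  in-last {zero , b}           x∈ = contradiction (b , x∈) zero∉
  in-last {suc zero , b}       x∈ = contradiction (b , x∈) one∉
  in-last {suc (suc zero) , _} _  = refl
two-gap⇒≤length {suc m} {S} (_ , dom , conn , _) zero∉ one∉ =
  contains+meets⇒≤length ends window ends-injective (Finₚ.suc-injective ∘ Finₚ.suc-injective)
    ends-contained meets
  where
  two-contains : ContainsColumn S (suc (suc zero))
  two-contains = next-contains dom one∉ zero∉
  last-contains : ContainsColumn S (fromℕ (3 + m))
  last-contains = prev-contains dom zero∉ one∉
  ends : Fin 2 → Fin (4 + m)
  ends zero       = suc (suc zero)
  ends (suc zero) = fromℕ (3 + m)
  ends-injective : Injective _≡_ _≡_ ends
  ends-injective {zero}     {zero}     _  = refl
  ends-injective {zero}     {suc zero} ()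
  ends-injective {suc zero} {zero}     ()
  ends-injective {suc zero} {suc zero} _  = refl
  ends-contained : ∀ l → ContainsColumn S (ends l)
  ends-contained zero       = two-contains
  ends-contained (suc zero) = last-contains
  window : Fin (2 + m) → Fin (4 + m)
  window j = suc (suc j)
  meets : ∀ j → MeetsColumn S (window j)
  meets j = between-meets zero∉ (conn _ _ (proj₁ two-contains) (proj₁ last-contains))
    (s≤s (s≤s z≤n)) (Finₚ.≤fromℕ (window j))

missing-zero⇒≤length : ∀ {S : List (V (3 + m))} → IsConnDomForcing S → ¬ MeetsColumn S zero →
                       3 + m ≤ length S
missing-zero⇒≤length {m} {S} cdf zero∉ with meets? S (suc zero) | meets? S (fromℕ (2 + m))
... | no  one∉ | _        = two-gap⇒≤length cdf zero∉ one∉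
... | yes one∈ | yes last∈ = one-gap⇒≤length cdf zero∉ one∈ last∈
-- Rotating forward moves the empty columns {n - 1, 0} to {0, 1}.
... | yes _    | no  last∉ =
  subst (_ ≤_) (length-map _ S)
    (two-gap⇒≤length (RotateForward.IsConnDomForcing-map cdf) last∉′
      (RotateForward.¬MeetsColumn-map zero∉))
  where
  last∉′ : ¬ MeetsColumn (map (map₁ next) S) zero
  last∉′ = subst (¬_ ∘ MeetsColumn _) (next∘prev zero) (RotateForward.¬MeetsColumn-map last∉)

missed-column⇒≤length : ∀ (p : Fin (3 + m)) {S} → IsConnDomForcing S → ¬ MeetsColumn S p →
                        3 + m ≤ length S
missed-column⇒≤length {m} = <-weakInduction P missing-zero⇒≤length rotate-back
  where
  P : Fin (3 + m) → Set
  P p = ∀ {S} → IsConnDomForcing S → ¬ MeetsColumn S p → 3 + m ≤ length S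
  rotate-back : ∀ j → P (inject₁ j) → P (suc j)
  rotate-back j ih {S} cdf p∉ =
    subst (_ ≤_) (length-map _ S)
      (ih (RotateBack.IsConnDomForcing-map cdf) (RotateBack.¬MeetsColumn-map p∉))

n≤length : ∀ {S : List (V (3 + m))} → IsConnDomForcing S → 3 + m ≤ length S
n≤length {m} {S} cdf with Finₚ.all? (meets? S)
... | yes meets-all = meets-all⇒≤length meets-all
... | no ¬meets-all with p , p∉ ← Finₚ.¬∀⟶∃¬ _ _ (meets? S) ¬meets-all =
  missed-column⇒≤length p cdf p∉

module _ {k : ℕ} where

  cycleCopy : List (V (suc k))
  cycleCopy = map (_, false) (allFin (suc k))

  ∈-cycleCopy : ∀ i → (i , false) ∈ cycleCopy
  ∈-cycleCopy i = ∈-map⁺ (_, false) (∈-allFin i)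

  length-cycleCopy : length cycleCopy ≡ suc k
  length-cycleCopy = trans (length-map (_, false) (allFin (suc k))) (length-tabulate id)

  cycleCopy-connected : IsConnectedIn cycleCopy
  cycleCopy-connected = hub⇒IsConnectedIn (zero , false) reach
    where
    reach-row : ∀ i → ReachIn cycleCopy (zero , false) (i , false)
    reach-row = <-weakInduction _ (here (∈-cycleCopy zero))
      (λ j r → step r (cycFwd (inj₁ (cong suc (Finₚ.toℕ-inject₁ j)))) (∈-cycleCopy (suc j)))
    reach : ∀ {v} → v ∈ cycleCopy → ReachIn cycleCopy (zero , false) v
    reach v∈ with ∈-map⁻ (_, false) v∈
    ... | i , _ , refl = reach-row i

  cycleCopy-forcing : IsZeroForcing cycleCopy
  cycleCopy-forcing (i , false) = init (∈-cycleCopy i)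
  cycleCopy-forcing (i , true)  = force (init (∈-cycleCopy i)) rung others
    where
    others : ∀ w → Adj (i , false) w → w ≢ (i , true) → Forced cycleCopy w
    others w a w≢ with Adj-cases a
    ... | inj₁ refl        = init (∈-cycleCopy (next i))
    ... | inj₂ (inj₁ refl) = init (∈-cycleCopy (prev i))
    ... | inj₂ (inj₂ refl) = contradiction refl w≢

  cycleCopy-IsConnDomForcing : IsConnDomForcing cycleCopy
  cycleCopy-IsConnDomForcing = Uniqueₚ.map⁺ (cong proj₁) (Uniqueₚ.allFin⁺ (suc k)) , dominating ,
                               cycleCopy-connected , cycleCopy-forcing
    where
    dominating : IsDominating cycleCopy
    dominating (i , false) = inj₁ (∈-cycleCopy i)
    dominating (i , true)  = inj₂ ((i , false) , ∈-cycleCopy i , rung)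

mainTheorem20 : ∀ (n : ℕ) → 3 ≤ n → FcdIs n n
mainTheorem20 zero             ()
mainTheorem20 (suc zero)       (s≤s ())
mainTheorem20 (suc (suc zero)) (s≤s (s≤s ()))
mainTheorem20 (suc (suc (suc m))) _ =
  (cycleCopy , cycleCopy-IsConnDomForcing , length-cycleCopy) , λ S → n≤length
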